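{- For all positive integers $n,k,\ell$ with $k\geq 3$ and $\ell\geq 5$: $A_b(\overline{K}_n)=1$, $A_b(P_\ell)=3$ and $A_b(C_k)=3$.
   Context: $\overline{K}_n$ is the edgeless graph on $n$ vertices, $P_\ell$ the path on $\ell$ vertices, $C_k$ the cycle on $k$ vertices. A (proper) $k$-coloring of $G$ is a map $c:V(G)\to[k]$ with adjacent vertices colored differently, all $k$ colors used; $V_i=c^{ -1}(i)$. A coloring is acyclic if $G[V_i\cup V_j]$ is a forest for all $i,j$. A vertex $v$ is a b-vertex if the colors on $v$ and its neighbors are all $k$ colors. A recoloring step applied to $c$ and a color $i$ having no b-vertex recolors every $v\in V_i$ with a color of $[k]$ not appearing on $v$ or its neighbors, producing a $(k-1)$-coloring; if both colorings are acyclic it is an acyclic recoloring step. The acyclic b-chromatic number $A_b(G)$ is the maximum number of colors of an acyclic coloring of $G$ to which no acyclic recoloring step can be applied. -}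

module Defs where

open import Data.Nat using (ℕ; zero; suc; _≤_; _≥_)
open import Data.Fin using (Fin; toℕ; inject₁; fromℕ) renaming (zero to fzero; suc to fsuc)
open import Data.Product using (Σ; ∃; _×_; _,_)
open import Data.Sum using (_⊎_)
open import Data.Empty using (⊥)
open import Relation.Nullary using (¬_)
open import Relation.Binary.PropositionalEquality using (_≡_; _≢_)
open import Function.Definitions using (Injective)

record Graph : Set₁ where
  field
    n      : ℕ
    Adj    : Fin n → Fin n → Set
    adj-sym : ∀ {u v} → Adj u v → Adj v u
    adj-irrefl : ∀ {v} → ¬ Adj v v
open Graph public

edgeless : ℕ → Graph
edgeless m = record { n = m ; Adj = λ _ _ → ⊥ ; adj-sym = λ () ; adj-irrefl = λ () }

pathAdj : ∀ {m} → Fin m → Fin m → Set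
pathAdj i j = toℕ j ≡ suc (toℕ i) ⊎ toℕ i ≡ suc (toℕ j)

cycleAdj : ∀ {m} → Fin m → Fin m → Set
cycleAdj {m} i j =
  pathAdj i j ⊎ ((toℕ i ≡ 0 × suc (toℕ j) ≡ m) ⊎ (toℕ j ≡ 0 × suc (toℕ i) ≡ m))

private
  open import Data.Sum using (inj₁; inj₂)
  open import Data.Nat.Properties using (<-irrefl; n<1+n)

  n≢1+n : ∀ m → m ≢ suc m
  n≢1+n m e = <-irrefl e (n<1+n m)
  open import Relation.Binary.PropositionalEquality using (sym; trans)

  pathSym : ∀ {m} {i j : Fin m} → pathAdj i j → pathAdj j i
  pathSym (inj₁ p) = inj₂ p
  pathSym (inj₂ p) = inj₁ p

  pathIrr : ∀ {m} {i : Fin m} → ¬ pathAdj i i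
  pathIrr {i = i} (inj₁ p) = n≢1+n (toℕ i) p
  pathIrr {i = i} (inj₂ p) = n≢1+n (toℕ i) p

  cycSym : ∀ {m} {i j : Fin m} → cycleAdj i j → cycleAdj j i
  cycSym (inj₁ p) = inj₁ (pathSym p)
  cycSym (inj₂ (inj₁ p)) = inj₂ (inj₂ p)
  cycSym (inj₂ (inj₂ p)) = inj₂ (inj₁ p)

-- Irreflexivity of cycleAdj needs m ≥ 3 (m = 1 would give a loop), so the
-- cycle graph C_k takes a proof of 3 ≤ k.
  open import Data.Nat using (_<_; s≤s; z≤n)
  open import Relation.Binary.PropositionalEquality using (subst; cong)

  cycIrr : ∀ {m} → 3 ≤ m → {i : Fin m} → ¬ cycleAdj i i
  cycIrr _ (inj₁ p) = pathIrr p
  cycIrr {m} h {i} (inj₂ (inj₁ (a , b))) = bad (trans (sym b) (cong suc a))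
    where
    bad : m ≢ 1
    bad e with subst (3 ≤_) e h
    ... | s≤s ()
  cycIrr {m} h {i} (inj₂ (inj₂ (a , b))) = bad (trans (sym b) (cong suc a))
    where
    bad : m ≢ 1
    bad e with subst (3 ≤_) e h
    ... | s≤s ()

path : ℕ → Graph
path m = record { n = m ; Adj = pathAdj ; adj-sym = pathSym ; adj-irrefl = pathIrr }

cycle : (m : ℕ) → 3 ≤ m → Graph
cycle m h = record { n = m ; Adj = cycleAdj ; adj-sym = cycSym ; adj-irrefl = cycIrr h }

module _ (G : Graph) where
  private
    V = Fin (n G)
    _~_ = Adj G

  Proper : ∀ {k} → (V → Fin k) → Set
  Proper c = ∀ u v → u ~ v → c u ≢ c v

  IsColoring : ∀ {k} → (V → Fin k) → Set
  IsColoring c = Proper c × (∀ j → ∃ λ v → c v ≡ j)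

  record Cycle : Set where
    field
      len  : ℕ
      vert : Fin (suc (suc (suc len))) → V
      inj  : Injective _≡_ _≡_ vert
      step : ∀ (t : Fin (suc (suc len))) → vert (inject₁ t) ~ vert (fsuc t)
      close : vert (fromℕ (suc (suc len))) ~ vert fzero

  HasCycleIn : (V → Set) → Set
  HasCycleIn S = Σ Cycle λ C → ∀ t → S (Cycle.vert C t)

  Acyclic : ∀ {k} → (V → Fin k) → Set
  Acyclic c = ∀ i j → ¬ HasCycleIn (λ v → c v ≡ i ⊎ c v ≡ j)

  IsBVertex : ∀ {k} → (V → Fin k) → V → Set
  IsBVertex c v = ∀ j → c v ≡ j ⊎ (∃ λ u → v ~ u × c u ≡ j)

  RecoloringStep : ∀ {k} → (V → Fin k) → Fin k → (V → Fin k) → Set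
  RecoloringStep c i c' =
    (∀ v → ¬ IsBVertex c v ⊎ c v ≢ i) ×
    (∀ v → (c v ≢ i → c' v ≡ c v) ×
           (c v ≡ i → c' v ≢ i × (∀ u → v ~ u → c' v ≢ c u)))

  AcyclicRecoloringStep : ∀ {k} → (V → Fin k) → Fin k → (V → Fin k) → Set
  AcyclicRecoloringStep c i c' = RecoloringStep c i c' × Acyclic c × Acyclic c'

  AcyclicBColoring : ∀ {k} → (V → Fin k) → Set
  AcyclicBColoring {k} c =
    IsColoring c × Acyclic c × (∀ i c' → ¬ AcyclicRecoloringStep c i c')

  AbIs : ℕ → Set
  AbIs m = (Σ (V → Fin m) AcyclicBColoring) ×
           (∀ k (c : V → Fin k) → AcyclicBColoring c → k ≤ m)

-- A vertex of a graph of maximum degree d sees at most d + 1 colours, so a colouring with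
-- d + 2 or more colours has no b-vertex, and each vertex of colour 0 can be given one of
-- d + 1 further colours absent from its neighbourhood.  For the forests K̄ₙ and P_ℓ the
-- result is trivially acyclic; in C_k every cycle passes through all vertices, so it
-- stays acyclic as long as three colours survive.  Hence A_b ≤ d + 1.  Conversely,
-- colour vertex a by a mod 3, except that the last vertex of C_k trades colour 0 for 1:
-- for ℓ ≥ 5 and k ≠ 4 every colour class contains a b-vertex, and on C₄ (coloured
-- 0,1,2,1) recolouring class 0 or 2 creates a bicoloured C₄.
module Submission where

open import Defs
open import Data.Bool using (Bool; true; false)
open import Data.Nat using (ℕ; zero; suc; _+_; _≤_; _<_; s≤s; z≤n)
  renaming (_≟_ to _≟ℕ_; _≤?_ to _≤?ℕ_)
open import Data.Nat.Properties using (<-irrefl; <-trans; n<1+n; ≤-refl; 0≢1+n; suc-injective; +-identityʳ; m≤m+n; ≰⇒>; m≤n⇒∃[o]m+o≡n)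
open import Data.Fin using (Fin; #_; toℕ; inject₁; fromℕ; _↑ˡ_; punchOut; _≟_)
  renaming (zero to fzero; suc to fsuc)
open import Data.Fin.Properties
  using (toℕ-injective; toℕ<n; toℕ-inject₁; toℕ-fromℕ; ↑ˡ-injective; punchOut-injective; pigeonhole; any?; <⇒≢)
  renaming (suc-injective to fsuc-injective)
open import Data.Fin.Relation.Unary.Top using (view; ‵fromℕ; ‵inject₁)
open import Data.Product using (Σ; ∃; ∃₂; _×_; _,_; proj₁; proj₂)
open import Data.Sum using (_⊎_; inj₁; inj₂)
open import Data.Empty using (⊥-elim)
open import Function using (_∘_; id)
open import Function.Definitions using (Injective)
open import Relation.Nullary using (¬_; Dec; yes; no; does)
open import Relation.Nullary.Decidable using (_×-dec_; _⊎-dec_; ¬?; decidable-stable; dec-true; dec-false)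
open import Relation.Binary.PropositionalEquality using (_≡_; _≢_; refl; sym; trans; cong; subst; module ≡-Reasoning)

private
  variable
    k : ℕ

module Recolouring (G : Graph) {c c' : Fin (n G) → Fin k} {i : Fin k} (step : RecoloringStep G c i c') where

  keeps : ∀ {v} → c v ≢ i → c' v ≡ c v
  keeps {v} = proj₁ (proj₂ step v)

  avoids-old : ∀ {v} → c v ≡ i → c' v ≢ i
  avoids-old {v} e = proj₁ (proj₂ (proj₂ step v) e)

  avoids-neighbours : ∀ {v u} → c v ≡ i → Adj G v u → c' v ≢ c u
  avoids-neighbours {v} {u} e = proj₂ (proj₂ (proj₂ step v) e) u

  b-vertex-blocks : ∀ {v} → c v ≡ i → ¬ IsBVertex G c v
  b-vertex-blocks {v} e with proj₁ step v
  ... | inj₁ ¬b = ¬b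
  ... | inj₂ ≢i = ⊥-elim (≢i e)

every-class-has-b-vertex-⇒-no-step : ∀ {G} (c : Fin (n G) → Fin k) →
  (∀ i → ∃ λ v → c v ≡ i × IsBVertex G c v) → ∀ i c' → ¬ AcyclicRecoloringStep G c i c'
every-class-has-b-vertex-⇒-no-step {G = G} c b-vertex i c' (step , _) with b-vertex i
... | v , e , b = Recolouring.b-vertex-blocks G step e b

forest-acyclic : ∀ {G} → ¬ Cycle G → (c : Fin (n G) → Fin k) → Acyclic G c
forest-acyclic no-cycle c i j (C , _) = no-cycle C

fin2-collision : (p q r : Fin 2) → p ≡ q ⊎ p ≡ r ⊎ q ≡ r
fin2-collision fzero        fzero        _            = inj₁ refl
fin2-collision (fsuc fzero) (fsuc fzero) _            = inj₁ refl
fin2-collision fzero        (fsuc fzero) fzero        = inj₂ (inj₁ refl)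
fin2-collision fzero        (fsuc fzero) (fsuc fzero) = inj₂ (inj₂ refl)
fin2-collision (fsuc fzero) fzero        fzero        = inj₂ (inj₂ refl)
fin2-collision (fsuc fzero) fzero        (fsuc fzero) = inj₂ (inj₁ refl)

rainbow-b-vertex : ∀ G {c : Fin (n G) → Fin 3} {v} u w → Adj G v u → Adj G v w →
  c v ≢ c u → c v ≢ c w → c u ≢ c w → IsBVertex G c v
rainbow-b-vertex G {c} {v} u w vu vw v≢u v≢w u≢w j with c v ≟ j | c u ≟ j | c w ≟ j
... | yes e | _     | _     = inj₁ e
... | no _  | yes e | _     = inj₂ (u , vu , e)
... | no _  | no _  | yes e = inj₂ (w , vw , e)
... | no a  | no b  | no d  with fin2-collision (punchOut (a ∘ sym)) (punchOut (b ∘ sym)) (punchOut (d ∘ sym))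
...   | inj₁ p        = ⊥-elim (v≢u (punchOut-injective (a ∘ sym) (b ∘ sym) p))
...   | inj₂ (inj₁ p) = ⊥-elim (v≢w (punchOut-injective (a ∘ sym) (d ∘ sym) p))
...   | inj₂ (inj₂ p) = ⊥-elim (u≢w (punchOut-injective (b ∘ sym) (d ∘ sym) p))

three-colours-not-in-pair : (f : Fin 3 → Fin k) → Injective _≡_ _≡_ f →
  ∀ i j → ¬ (∀ t → f t ≡ i ⊎ f t ≡ j)
three-colours-not-in-pair f f-injective i j in-pair =
  let t , t' , t<t' , same = pigeonhole (s≤s (s≤s (s≤s z≤n))) (side ∘ in-pair)
  in <⇒≢ t<t' (f-injective (same-side (in-pair t) (in-pair t') same))
  where
  side : ∀ {x} → x ≡ i ⊎ x ≡ j → Fin 2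
  side (inj₁ _) = fzero
  side (inj₂ _) = fsuc fzero
  same-side : ∀ {x y} (p : x ≡ i ⊎ x ≡ j) (q : y ≡ i ⊎ y ≡ j) → side p ≡ side q → x ≡ y
  same-side (inj₁ p) (inj₁ q) _ = trans p (sym q)
  same-side (inj₂ p) (inj₂ q) _ = trans p (sym q)

outside-pair : (f : Fin 3 → Fin k) → Injective _≡_ _≡_ f → ∀ i j → ∃ λ t → f t ≢ i × f t ≢ j
outside-pair f f-injective i j with any? (λ t → ¬? (f t ≟ i) ×-dec ¬? (f t ≟ j))
... | yes found = found
... | no none = ⊥-elim (three-colours-not-in-pair f f-injective i j in-pair)
  where
  in-pair : ∀ t → f t ≡ i ⊎ f t ≡ j
  in-pair t with f t ≟ i | f t ≟ j
  ... | yes e | _     = inj₁ e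
  ... | no _  | yes e = inj₂ e
  ... | no ≢i | no ≢j = ⊥-elim (none (t , ≢i , ≢j))

palette : ∀ {d} → Fin (suc d) → Fin (2 + d + k)
palette {k} t = fsuc (t ↑ˡ k)

palette-injective : ∀ {d} → Injective _≡_ _≡_ (palette {k} {d})
palette-injective {k} = ↑ˡ-injective k _ _ ∘ fsuc-injective

palette-≢0 : ∀ {d} (t : Fin (suc d)) → palette {k} t ≢ fzero
palette-≢0 t ()

-- Degree at most d, encoded as an injective labelling of every neighbourhood by Fin d.
record MaxDegree (d : ℕ) (G : Graph) : Set where
  field
    adj? : ∀ u v → Dec (Adj G u v)
    label : ∀ {u v} → Adj G u v → Fin d
    label-injective : ∀ {u v w} (a : Adj G u v) (b : Adj G u w) → label a ≡ label b → v ≡ w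

module BoundedDegree {d : ℕ} {G : Graph} (Δ : MaxDegree d G) where
  open MaxDegree Δ

  private
    V : Set
    V = Fin (n G)

  no-b-vertex : (c : V → Fin (2 + d + k)) → ∀ v → ¬ IsBVertex G c v
  no-b-vertex {k} c v b-vertex =
    let i , j , i<j , same = pigeonhole (s≤s (s≤s (m≤m+n d k))) (λ j → position (b-vertex j))
    in <⇒≢ i<j (position-injective (b-vertex i) (b-vertex j) same)
    where
    Seen : Fin (2 + d + k) → Set
    Seen j = c v ≡ j ⊎ ∃ λ u → Adj G v u × c u ≡ j
    position : ∀ {j} → Seen j → Fin (suc d)
    position (inj₁ _) = fzero
    position (inj₂ (_ , a , _)) = fsuc (label a)
    position-injective : ∀ {i j} (p : Seen i) (q : Seen j) → position p ≡ position q → i ≡ j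
    position-injective (inj₁ p) (inj₁ q) _ = trans (sym p) q
    position-injective (inj₂ (_ , a , p)) (inj₂ (_ , b , q)) same
      with label-injective a b (fsuc-injective same)
    ... | refl = trans (sym p) q

  NeighbourColour : (V → Fin k) → V → Fin k → Set
  NeighbourColour c v x = ∃ λ u → Adj G v u × c u ≡ x

  neighbour-colour? : (c : V → Fin k) → ∀ v x → Dec (NeighbourColour c v x)
  neighbour-colour? c v x = any? (λ u → adj? v u ×-dec (c u ≟ x))

  neighbourhood-misses-one-of : (c : V → Fin k) (f : Fin (suc d) → Fin k) → Injective _≡_ _≡_ f →
    ∀ v → ¬ (∀ t → NeighbourColour c v (f t))
  neighbourhood-misses-one-of c f f-injective v near =
    let t , t' , t<t' , same = pigeonhole ≤-refl (λ t → label (neighbour t))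
    in <⇒≢ t<t' (f-injective (same-colour t t' same))
    where
    open ≡-Reasoning
    neighbour : ∀ t → Adj G v (proj₁ (near t))
    neighbour t = proj₁ (proj₂ (near t))
    same-colour : ∀ t t' → label (neighbour t) ≡ label (neighbour t') → f t ≡ f t'
    same-colour t t' same = begin
      f t                    ≡⟨ sym (proj₂ (proj₂ (near t))) ⟩
      c (proj₁ (near t))     ≡⟨ cong c (label-injective (neighbour t) (neighbour t') same) ⟩
      c (proj₁ (near t'))    ≡⟨ proj₂ (proj₂ (near t')) ⟩
      f t'                   ∎

  free-colour : (c : V → Fin (2 + d + k)) → ∀ v → ∃ λ t → ¬ NeighbourColour c v (palette t)
  free-colour c v with any? (λ t → ¬? (neighbour-colour? c v (palette t)))
  ... | yes free = free
  ... | no none = ⊥-elim (neighbourhood-misses-one-of c palette palette-injective v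
    (λ t → decidable-stable (neighbour-colour? c v (palette t)) (λ absent → none (t , absent))))

  recolour : (c : V → Fin (2 + d + k)) → V → Fin (2 + d + k)
  recolour c v with c v ≟ fzero
  ... | yes _ = palette (proj₁ (free-colour c v))
  ... | no _  = c v

  recolour-step : (c : V → Fin (2 + d + k)) → RecoloringStep G c fzero (recolour c)
  recolour-step c = (λ v → inj₁ (no-b-vertex c v)) , λ v → kept v , moved v
    where
    kept : ∀ v → c v ≢ fzero → recolour c v ≡ c v
    kept v ≢0 with c v ≟ fzero
    ... | yes ≡0 = ⊥-elim (≢0 ≡0)
    ... | no _   = refl
    moved : ∀ v → c v ≡ fzero → recolour c v ≢ fzero × (∀ u → Adj G v u → recolour c v ≢ c u)
    moved v ≡0 with c v ≟ fzero
    ... | no ≢0 = ⊥-elim (≢0 ≡0)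
    ... | yes _ = (λ ()) , λ u a e → proj₂ (free-colour c v) (u , a , sym e)

  Ab-≤-1+d : (∀ {k} (c c' : V → Fin (2 + d + k)) →
               IsColoring G c → RecoloringStep G c fzero c' → Acyclic G c') →
             ∀ k (c : V → Fin k) → AcyclicBColoring G c → k ≤ suc d
  Ab-≤-1+d recolouring-acyclic k c (colouring , acyclic , no-step) with k ≤?ℕ suc d
  ... | yes k≤1+d = k≤1+d
  ... | no k≰1+d with m≤n⇒∃[o]m+o≡n (≰⇒> k≰1+d)
  ... | _ , refl = ⊥-elim (no-step fzero (recolour c)
          (recolour-step c , acyclic , recolouring-acyclic c (recolour c) colouring (recolour-step c)))

edgeless-max-degree : ∀ m → MaxDegree 0 (edgeless m)
edgeless-max-degree m = record { adj? = λ _ _ → no (λ ()) ; label = λ () ; label-injective = λ () }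

Succ : ∀ {m} → Fin m → Fin m → Set
Succ {m} u v = toℕ v ≡ suc (toℕ u) ⊎ (toℕ v ≡ 0 × suc (toℕ u) ≡ m)

module _ {m : ℕ} where
  private
    variable
      u v w : Fin m

  succ-or-pred : cycleAdj u v → Succ u v ⊎ Succ v u
  succ-or-pred (inj₁ (inj₁ p)) = inj₁ (inj₁ p)
  succ-or-pred (inj₁ (inj₂ p)) = inj₂ (inj₁ p)
  succ-or-pred (inj₂ (inj₁ p)) = inj₂ (inj₂ p)
  succ-or-pred (inj₂ (inj₂ p)) = inj₁ (inj₂ p)

  succ-functional : Succ u v → Succ u w → v ≡ w
  succ-functional (inj₁ p)       (inj₁ q)       = toℕ-injective (trans p (sym q))
  succ-functional {v = v} (inj₁ p) (inj₂ (_ , q)) = ⊥-elim (<-irrefl (trans p q) (toℕ<n v))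
  succ-functional {w = w} (inj₂ (_ , q)) (inj₁ p) = ⊥-elim (<-irrefl (trans p q) (toℕ<n w))
  succ-functional (inj₂ (p , _)) (inj₂ (q , _)) = toℕ-injective (trans p (sym q))

  succ-injective : Succ u w → Succ v w → u ≡ v
  succ-injective (inj₁ p)       (inj₁ q)       = toℕ-injective (suc-injective (trans (sym p) q))
  succ-injective (inj₁ p)       (inj₂ (q , _)) = ⊥-elim (0≢1+n (trans (sym q) p))
  succ-injective (inj₂ (q , _)) (inj₁ p)       = ⊥-elim (0≢1+n (trans (sym q) p))
  succ-injective (inj₂ (_ , p)) (inj₂ (_ , q)) = toℕ-injective (suc-injective (trans p (sym q)))

  succ-value : suc (toℕ u) < m → Succ u v → toℕ v ≡ suc (toℕ u)
  succ-value _  (inj₁ p)       = p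
  succ-value lt (inj₂ (_ , q)) = ⊥-elim (<-irrefl q lt)

  pred-value : ∀ {j} → toℕ v ≡ suc j → Succ u v → toℕ u ≡ j
  pred-value e (inj₁ p)       = suc-injective (trans (sym p) e)
  pred-value e (inj₂ (p , _)) = ⊥-elim (0≢1+n (trans (sym p) e))

  distinct-neighbours : cycleAdj u v → cycleAdj u w → v ≢ w →
    Succ u v × Succ w u ⊎ Succ u w × Succ v u
  distinct-neighbours uv uw v≢w with succ-or-pred uv | succ-or-pred uw
  ... | inj₁ u↦v | inj₁ u↦w = ⊥-elim (v≢w (succ-functional u↦v u↦w))
  ... | inj₁ u↦v | inj₂ w↦u = inj₁ (u↦v , w↦u)
  ... | inj₂ v↦u | inj₁ u↦w = inj₂ (u↦w , v↦u)
  ... | inj₂ v↦u | inj₂ w↦u = ⊥-elim (v≢w (succ-injective v↦u w↦u))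

  direction : cycleAdj u v → Fin 2
  direction a with succ-or-pred a
  ... | inj₁ _ = fzero
  ... | inj₂ _ = fsuc fzero

  direction-injective : (a : cycleAdj u v) (b : cycleAdj u w) → direction a ≡ direction b → v ≡ w
  direction-injective a b with succ-or-pred a | succ-or-pred b
  ... | inj₁ p | inj₁ q = λ _ → succ-functional p q
  ... | inj₂ p | inj₂ q = λ _ → succ-injective p q
  ... | inj₁ _ | inj₂ _ = λ ()
  ... | inj₂ _ | inj₁ _ = λ ()

pathAdj? : ∀ {m} (u v : Fin m) → Dec (pathAdj u v)
pathAdj? u v = (toℕ v ≟ℕ suc (toℕ u)) ⊎-dec (toℕ u ≟ℕ suc (toℕ v))

cycleAdj? : ∀ {m} (u v : Fin m) → Dec (cycleAdj u v)
cycleAdj? {m} u v = pathAdj? u v ⊎-dec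
  (((toℕ u ≟ℕ 0) ×-dec (suc (toℕ v) ≟ℕ m)) ⊎-dec ((toℕ v ≟ℕ 0) ×-dec (suc (toℕ u) ≟ℕ m)))

cycle-max-degree : ∀ m (h : 3 ≤ m) → MaxDegree 2 (cycle m h)
cycle-max-degree m h = record
  { adj? = cycleAdj? ; label = direction ; label-injective = direction-injective }

path-max-degree : ∀ ℓ → MaxDegree 2 (path ℓ)
path-max-degree ℓ = record
  { adj? = pathAdj?
  ; label = direction ∘ inj₁
  ; label-injective = λ a b → direction-injective (inj₁ a) (inj₁ b)
  }

inject₁²≢suc² : ∀ {m} (i : Fin m) → inject₁ (inject₁ i) ≢ fsuc (fsuc i)
inject₁²≢suc² fzero    ()
inject₁²≢suc² (fsuc i) e = inject₁²≢suc² i (fsuc-injective e)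

module _ {G : Graph} (C : Cycle G) where
  open Cycle C

  two-neighbours : ∀ s → ∃₂ λ a b → a ≢ b × Adj G (vert s) (vert a) × Adj G (vert s) (vert b)
  two-neighbours fzero = fsuc fzero , fromℕ _ , (λ ()) , step fzero , adj-sym G close
  two-neighbours (fsuc s) with view s
  ... | ‵fromℕ     = inject₁ (fromℕ _) , fzero , (λ ()) , adj-sym G (step (fromℕ _)) , close
  ... | ‵inject₁ r = inject₁ (inject₁ r) , fsuc (fsuc r) , inject₁²≢suc² r ,
                     adj-sym G (step (inject₁ r)) , step (fsuc r)

module SubgraphOfCycle {G : Graph} (embed : ∀ {u v} → Adj G u v → cycleAdj u v) (C : Cycle G) where
  open Cycle C

  OnCycle : ℕ → Set
  OnCycle j = ∃ λ s → toℕ (vert s) ≡ j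

  pred-on-cycle : ∀ {j} → OnCycle (suc j) → OnCycle j
  pred-on-cycle (s , e) with two-neighbours C s
  ... | a , b , a≢b , sa , sb with distinct-neighbours (embed sa) (embed sb) (a≢b ∘ inj)
  ... | inj₁ (_ , b↦s) = b , pred-value e b↦s
  ... | inj₂ (_ , a↦s) = a , pred-value e a↦s

  succ-on-cycle : ∀ {j} → suc j < n G → OnCycle j → OnCycle (suc j)
  succ-on-cycle lt (s , refl) with two-neighbours C s
  ... | a , b , a≢b , sa , sb with distinct-neighbours (embed sa) (embed sb) (a≢b ∘ inj)
  ... | inj₁ (s↦a , _) = a , succ-value lt s↦a
  ... | inj₂ (s↦b , _) = b , succ-value lt s↦b

  below-on-cycle : ∀ i {j} → OnCycle (i + j) → OnCycle j
  below-on-cycle zero    = id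
  below-on-cycle (suc i) = below-on-cycle i ∘ pred-on-cycle

  zero-on-cycle : OnCycle 0
  zero-on-cycle = below-on-cycle (toℕ (vert fzero)) (fzero , sym (+-identityʳ _))

  on-cycle : ∀ j → j < n G → OnCycle j
  on-cycle zero    _  = zero-on-cycle
  on-cycle (suc j) lt = succ-on-cycle lt (on-cycle j (<-trans (n<1+n j) lt))

  passes-through-all : ∀ w → ∃ λ s → vert s ≡ w
  passes-through-all w with on-cycle (toℕ w) (toℕ<n w)
  ... | s , e = s , toℕ-injective e

open SubgraphOfCycle using (zero-on-cycle; passes-through-all)

-- Vertex 0 of a cycle in P_ℓ would have two distinct neighbours, both equal to vertex 1.
path-forest : ∀ ℓ → ¬ Cycle (path ℓ)
path-forest ℓ C with zero-on-cycle inj₁ C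
... | s , e with two-neighbours C s
... | a , b , a≢b , sa , sb = a≢b (Cycle.inj C (toℕ-injective (trans (one sa) (sym (one sb)))))
  where
  one : ∀ {x} → pathAdj (Cycle.vert C s) x → toℕ x ≡ 1
  one (inj₁ p) = trans p (cong suc e)
  one (inj₂ p) = ⊥-elim (0≢1+n (trans (sym e) p))

cycle-acyclic : ∀ m (h : 3 ≤ m) (c : Fin m → Fin k) (f : Fin 3 → Fin k) → Injective _≡_ _≡_ f →
  (∀ t → ∃ λ v → c v ≡ f t) → Acyclic (cycle m h) c
cycle-acyclic m h c f f-injective hit i j (C , bicoloured) with outside-pair f f-injective i j
... | t , ≢i , ≢j with hit t
... | w , cw with passes-through-all id C w
... | s , refl with bicoloured s
... | inj₁ e = ≢i (trans (sym cw) e)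
... | inj₂ e = ≢j (trans (sym cw) e)

rot : Fin 3 → Fin 3
rot fzero               = # 1
rot (fsuc fzero)        = # 2
rot (fsuc (fsuc fzero)) = # 0

mod3 : ℕ → Fin 3
mod3 zero    = # 0
mod3 (suc a) = rot (mod3 a)

rot-≢ : ∀ x → x ≢ rot x
rot-≢ fzero               ()
rot-≢ (fsuc fzero)        ()
rot-≢ (fsuc (fsuc fzero)) ()

path-lower : ∀ ℓ → 5 ≤ ℓ → Σ (Fin ℓ → Fin 3) (AcyclicBColoring (path ℓ))
path-lower ℓ (s≤s (s≤s (s≤s (s≤s (s≤s _))))) =
  c , (proper , onto) , forest-acyclic (path-forest ℓ) c , every-class-has-b-vertex-⇒-no-step c b-vertex
  where
  c : Fin ℓ → Fin 3
  c = mod3 ∘ toℕ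
  proper : Proper (path ℓ) c
  proper u v (inj₁ p) e = rot-≢ (c u) (trans e (cong mod3 p))
  proper u v (inj₂ p) e = rot-≢ (c v) (trans (sym e) (cong mod3 p))
  onto : ∀ j → ∃ λ v → c v ≡ j
  onto fzero               = # 0 , refl
  onto (fsuc fzero)        = # 1 , refl
  onto (fsuc (fsuc fzero)) = # 2 , refl
  b-vertex : ∀ i → ∃ λ v → c v ≡ i × IsBVertex (path ℓ) c v
  b-vertex fzero               = # 3 , refl , rainbow-b-vertex (path ℓ) (# 2) (# 4) (inj₂ refl) (inj₁ refl) (λ ()) (λ ()) (λ ())
  b-vertex (fsuc fzero)        = # 1 , refl , rainbow-b-vertex (path ℓ) (# 0) (# 2) (inj₂ refl) (inj₁ refl) (λ ()) (λ ()) (λ ())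
  b-vertex (fsuc (fsuc fzero)) = # 2 , refl , rainbow-b-vertex (path ℓ) (# 1) (# 3) (inj₂ refl) (inj₁ refl) (λ ()) (λ ()) (λ ())

-- The last vertex of C_m trades colour 0 for 1, so that it differs from vertex 0.  Matching
-- on the colour first lets colours 1 and 2 compute even when the Bool does not.
trade0 : Bool → Fin 3 → Fin 3
trade0 _     (fsuc x) = fsuc x
trade0 true  fzero    = # 1
trade0 false fzero    = # 0

cycle-colour : ℕ → ℕ → Fin 3
cycle-colour m a = trade0 (does (m ≟ℕ suc a)) (mod3 a)

cycle-colouring : ∀ m → Fin m → Fin 3
cycle-colouring m = cycle-colour m ∘ toℕ

trade0-false : ∀ x → trade0 false x ≡ x
trade0-false fzero    = refl
trade0-false (fsuc x) = refl

trade0-true-≢0 : ∀ x → trade0 true x ≢ # 0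
trade0-true-≢0 fzero    ()
trade0-true-≢0 (fsuc x) ()

trade0-rot-≢ : ∀ b x → x ≢ trade0 b (rot x)
trade0-rot-≢ b     fzero               ()
trade0-rot-≢ b     (fsuc fzero)        ()
trade0-rot-≢ true  (fsuc (fsuc fzero)) ()
trade0-rot-≢ false (fsuc (fsuc fzero)) ()

cycle-colour-inner : ∀ {m a} → suc a < m → cycle-colour m a ≡ mod3 a
cycle-colour-inner {m} {a} lt = trans
  (cong (λ b → trade0 b (mod3 a)) (dec-false (m ≟ℕ suc a) (λ m≡1+a → <-irrefl (sym m≡1+a) lt)))
  (trade0-false (mod3 a))

cycle-colour-last : ∀ {m a} → suc a ≡ m → cycle-colour m a ≡ trade0 true (mod3 a)
cycle-colour-last {m} {a} last = cong (λ b → trade0 b (mod3 a)) (dec-true (m ≟ℕ suc a) (sym last))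

module _ (m : ℕ) (h : 3 ≤ m) where

  cycle-colouring-succ : ∀ {u v : Fin m} → Succ u v → cycle-colouring m u ≢ cycle-colouring m v
  cycle-colouring-succ {u} {v} (inj₁ p) e = trade0-rot-≢ _ (mod3 (toℕ u)) (begin
    mod3 (toℕ u)                 ≡⟨ sym (cycle-colour-inner u+1<m) ⟩
    cycle-colour m (toℕ u)        ≡⟨ e ⟩
    cycle-colour m (toℕ v)        ≡⟨ cong (cycle-colour m) p ⟩
    cycle-colour m (suc (toℕ u))  ∎)
    where
    open ≡-Reasoning
    u+1<m : suc (toℕ u) < m
    u+1<m = subst (_< m) p (toℕ<n v)
  cycle-colouring-succ {u} {v} (inj₂ (v≡0 , last)) e = trade0-true-≢0 (mod3 (toℕ u)) (begin
    trade0 true (mod3 (toℕ u))   ≡⟨ sym (cycle-colour-last last) ⟩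
    cycle-colour m (toℕ u)        ≡⟨ e ⟩
    cycle-colour m (toℕ v)        ≡⟨ cong (cycle-colour m) v≡0 ⟩
    cycle-colour m 0              ≡⟨ cycle-colour-inner (<-trans (s≤s (s≤s z≤n)) h) ⟩
    # 0                          ∎)
    where open ≡-Reasoning

  cycle-colouring-proper : Proper (cycle m h) (cycle-colouring m)
  cycle-colouring-proper u v a with succ-or-pred a
  ... | inj₁ u↦v = cycle-colouring-succ u↦v
  ... | inj₂ v↦u = cycle-colouring-succ v↦u ∘ sym

whole-cycle : ∀ len (h : 3 ≤ 3 + len) → Cycle (cycle (3 + len) h)
whole-cycle len h = record
  { len = len
  ; vert = id
  ; inj = id
  ; step = λ t → inj₁ (inj₁ (cong suc (sym (toℕ-inject₁ t))))
  ; close = inj₂ (inj₂ (refl , cong suc (toℕ-fromℕ _)))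
  }

≢0,1⇒≡2 : ∀ {x : Fin 3} → x ≢ # 0 → x ≢ # 1 → x ≡ # 2
≢0,1⇒≡2 {fzero}               ≢0 _  = ⊥-elim (≢0 refl)
≢0,1⇒≡2 {fsuc fzero}          _  ≢1 = ⊥-elim (≢1 refl)
≢0,1⇒≡2 {fsuc (fsuc fzero)}   _  _  = refl

≢2,1⇒≡0 : ∀ {x : Fin 3} → x ≢ # 2 → x ≢ # 1 → x ≡ # 0
≢2,1⇒≡0 {fzero}               _  _  = refl
≢2,1⇒≡0 {fsuc fzero}          _  ≢1 = ⊥-elim (≢1 refl)
≢2,1⇒≡0 {fsuc (fsuc fzero)}   ≢2 _  = ⊥-elim (≢2 refl)

-- C₄ is coloured 0,1,2,1; recolouring class 0 or 2 yields 2,1,2,1 or 0,1,0,1.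
C₄-no-step : (h : 3 ≤ 4) → ∀ i c' → ¬ AcyclicRecoloringStep (cycle 4 h) (cycle-colouring 4) i c'
C₄-no-step h (fsuc fzero) c' (step , _) =
  Recolouring.b-vertex-blocks (cycle 4 h) step refl
    (rainbow-b-vertex (cycle 4 h) (# 0) (# 2) (inj₁ (inj₂ refl)) (inj₁ (inj₁ refl)) (λ ()) (λ ()) (λ ()))
C₄-no-step h fzero c' (step , _ , acyclic') = acyclic' (# 1) (# 2) (whole-cycle 1 h , bicoloured)
  where
  open Recolouring (cycle 4 h) step
  bicoloured : ∀ t → c' t ≡ # 1 ⊎ c' t ≡ # 2
  bicoloured fzero                      = inj₂ (≢0,1⇒≡2 (avoids-old refl)
    (avoids-neighbours refl (inj₁ (inj₁ refl))))
  bicoloured (fsuc fzero)               = inj₁ (keeps (λ ()))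
  bicoloured (fsuc (fsuc fzero))        = inj₂ (keeps (λ ()))
  bicoloured (fsuc (fsuc (fsuc fzero))) = inj₁ (keeps (λ ()))
C₄-no-step h (fsuc (fsuc fzero)) c' (step , _ , acyclic') = acyclic' (# 0) (# 1) (whole-cycle 1 h , bicoloured)
  where
  open Recolouring (cycle 4 h) step
  bicoloured : ∀ t → c' t ≡ # 0 ⊎ c' t ≡ # 1
  bicoloured fzero                      = inj₁ (keeps (λ ()))
  bicoloured (fsuc fzero)               = inj₂ (keeps (λ ()))
  bicoloured (fsuc (fsuc fzero))        = inj₁ (≢2,1⇒≡0 (avoids-old refl)
    (avoids-neighbours refl (inj₁ (inj₂ refl))))
  bicoloured (fsuc (fsuc (fsuc fzero))) = inj₂ (keeps (λ ()))

cycle-no-step : ∀ m (h : 3 ≤ m) i c' → ¬ AcyclicRecoloringStep (cycle m h) (cycle-colouring m) i c'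
cycle-no-step 0 ()
cycle-no-step 1 (s≤s ())
cycle-no-step 2 (s≤s (s≤s ()))
cycle-no-step 3 h = every-class-has-b-vertex-⇒-no-step (cycle-colouring 3) b-vertex
  where
  b-vertex : ∀ i → ∃ λ v → cycle-colouring 3 v ≡ i × IsBVertex (cycle 3 h) (cycle-colouring 3) v
  b-vertex fzero               = # 0 , refl , rainbow-b-vertex (cycle 3 h) (# 1) (# 2)
    (inj₁ (inj₁ refl)) (inj₂ (inj₁ (refl , refl))) (λ ()) (λ ()) (λ ())
  b-vertex (fsuc fzero)        = # 1 , refl , rainbow-b-vertex (cycle 3 h) (# 0) (# 2)
    (inj₁ (inj₂ refl)) (inj₁ (inj₁ refl)) (λ ()) (λ ()) (λ ())
  b-vertex (fsuc (fsuc fzero)) = # 2 , refl , rainbow-b-vertex (cycle 3 h) (# 1) (# 0)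
    (inj₁ (inj₂ refl)) (inj₂ (inj₂ (refl , refl))) (λ ()) (λ ()) (λ ())
cycle-no-step 4 h = C₄-no-step h
cycle-no-step m@(suc (suc (suc (suc (suc _))))) h =
  every-class-has-b-vertex-⇒-no-step (cycle-colouring m) b-vertex
  where
  b-vertex : ∀ i → ∃ λ v → cycle-colouring m v ≡ i × IsBVertex (cycle m h) (cycle-colouring m) v
  b-vertex fzero               = # 3 , refl , rainbow-b-vertex (cycle m h) (# 2) (# 4)
    (inj₁ (inj₂ refl)) (inj₁ (inj₁ refl)) (λ ()) (λ ()) (λ ())
  b-vertex (fsuc fzero)        = # 1 , refl , rainbow-b-vertex (cycle m h) (# 0) (# 2)
    (inj₁ (inj₂ refl)) (inj₁ (inj₁ refl)) (λ ()) (λ ()) (λ ())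
  b-vertex (fsuc (fsuc fzero)) = # 2 , refl , rainbow-b-vertex (cycle m h) (# 1) (# 3)
    (inj₁ (inj₂ refl)) (inj₁ (inj₁ refl)) (λ ()) (λ ()) (λ ())

cycle-lower : ∀ m (h : 3 ≤ m) → Σ (Fin m → Fin 3) (AcyclicBColoring (cycle m h))
cycle-lower m@(suc (suc (suc _))) h@(s≤s (s≤s (s≤s _))) =
  c , (cycle-colouring-proper m h , onto) , cycle-acyclic m h c id id onto , cycle-no-step m h
  where
  c : Fin m → Fin 3
  c = cycle-colouring m
  onto : ∀ j → ∃ λ v → c v ≡ j
  onto fzero               = # 0 , refl
  onto (fsuc fzero)        = # 1 , refl
  onto (fsuc (fsuc fzero)) = # 2 , refl

cycle-recolouring-acyclic : ∀ m (h : 3 ≤ m) (c c' : Fin m → Fin (2 + 2 + k)) →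
  IsColoring (cycle m h) c → RecoloringStep (cycle m h) c fzero c' → Acyclic (cycle m h) c'
cycle-recolouring-acyclic m h c c' (_ , onto) step =
  cycle-acyclic m h c' palette palette-injective still-used
  where
  still-used : ∀ t → ∃ λ v → c' v ≡ palette t
  still-used t with onto (palette t)
  ... | v , e = v , trans (Recolouring.keeps (cycle m h) step (palette-≢0 t ∘ trans (sym e))) e

edgeless-forest : ∀ m → ¬ Cycle (edgeless m)
edgeless-forest m C = Cycle.step C fzero

edgeless-lower : ∀ m → 1 ≤ m → Σ (Fin m → Fin 1) (AcyclicBColoring (edgeless m))
edgeless-lower m@(suc _) _ = c , ((λ _ _ ()) , onto) , forest-acyclic (edgeless-forest m) c , no-step
  where
  c : Fin m → Fin 1
  c _ = fzero
  onto : ∀ j → ∃ λ v → c v ≡ j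
  onto fzero = fzero , refl
  no-step : ∀ i c' → ¬ AcyclicRecoloringStep (edgeless m) c i c'
  no-step fzero c' (step , _) with c' fzero | Recolouring.avoids-old (edgeless m) step {fzero} refl
  ... | fzero | ≢0 = ≢0 refl

corollary3 : (n k ℓ : ℕ) → 1 ≤ n → (h : 3 ≤ k) → 5 ≤ ℓ →
    AbIs (edgeless n) 1 × AbIs (path ℓ) 3 × AbIs (cycle k h) 3
corollary3 n k ℓ n≥1 h ℓ≥5 =
    (edgeless-lower n n≥1 , Ab-≤-1+d (edgeless-max-degree n) (λ _ c' _ _ → forest-acyclic (edgeless-forest n) c'))
  , (path-lower ℓ ℓ≥5 , Ab-≤-1+d (path-max-degree ℓ) (λ _ c' _ _ → forest-acyclic (path-forest ℓ) c'))
  , (cycle-lower k h , Ab-≤-1+d (cycle-max-degree k h) (cycle-recolouring-acyclic k h))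
  where open BoundedDegree using (Ab-≤-1+d)
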